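{- Let $X\subseteq Y$ be sets, and let $<^X$ be a linear order on $X$ and $<^Y$ a linear order on $Y$, both of order type $\omega$, such that $<^X$ and $<^Y|_X$ almost agree. Then there is a linear order $\lessdot^Y$ on $Y$ of order type $\omega$ such that $\lessdot^Y$ almost agrees with $<^Y$ and $\lessdot^Y|_X=<^X$.
   Context: Two linear orders $<^1,<^2$ on a set $Z$ almost agree if there is a finite $Z_0\subseteq Z$ such that $<^1$ and $<^2$ coincide on $Z\setminus Z_0$. For $X\subseteq Y$, $<^Y|_X$ denotes the restriction of $<^Y$ to $X$. -}

module Defs where

open import Data.Nat using (ℕ) renaming (_<_ to _<ℕ_)
open import Data.Product using (Σ; ∃; _×_)
open import Data.List using (List)
open import Data.List.Membership.Propositional using (_∉_)
open import Function.Bundles using (_↔_; _⇔_; Inverse)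

Rel : Set → Set₁
Rel Z = Z → Z → Set

-- "_<_ is a linear order on Z of order type ω": there is an order
-- isomorphism between (Z , _<_) and (ℕ , <).  (Any relation order-isomorphic
-- to (ℕ,<) is automatically a strict linear order.)
OrderTypeω : (Z : Set) → Rel Z → Set
OrderTypeω Z _<_ =
  Σ (Z ↔ ℕ) λ f → ∀ x y → (x < y) ⇔ (Inverse.to f x <ℕ Inverse.to f y)

AlmostAgree : (Z : Set) → Rel Z → Rel Z → Set
AlmostAgree Z _<¹_ _<²_ =
  Σ (List Z) λ Z₀ → ∀ x y → x ∉ Z₀ → y ∉ Z₀ → (x <¹ y) ⇔ (x <² y)

-- Restriction of a relation on Y to a subset X, where X ⊆ Y is given by
-- an injective inclusion map ι : X → Y.
Restrict : {X Y : Set} → (X → Y) → Rel Y → Rel X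
Restrict ι _<_ a b = ι a < ι b

{-# OPTIONS --safe #-}
-- Enumerating X and Y by ℕ turns the inclusion into an injection h : ℕ → ℕ, and the
-- almost agreement makes h strictly increasing from some K on.  Past T = K + (a strict
-- bound of h below K) every value h j exceeds all earlier ones, so pigeonhole gives
-- T ≤ j ≤ h j.  Composing T transpositions yields a permutation σ with σ (h i) = i for
-- i < T that fixes every other number ≥ T, in particular every h j with j ≥ T.  Hence
-- σ ∘ h is strictly increasing while σ moves only finitely many points, and the order
-- on Y pulled back along σ ∘ (enumeration of Y) is the required one.

module Submission where

open import Defs
open import Data.Fin using (Fin; toℕ; fromℕ<)
open import Data.Fin.Properties using (injective⇒≤; toℕ-injective; toℕ<n; toℕ-fromℕ<)
open import Data.List using (List; map; _++_; upTo)
open import Data.List.Extrema.Nat using (max; xs≤max)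
open import Data.List.Membership.Propositional using (_∈_; _∉_)
open import Data.List.Membership.Propositional.Properties using (∈-map⁺; ∈-++⁺ˡ; ∈-++⁺ʳ; ∈-upTo⁺)
import Data.List.Relation.Unary.All as All
open import Data.Nat using (ℕ; zero; suc; _∸_; _+_; _≤_; _<_; z≤n; s≤s; s≤s⁻¹)
open import Data.Nat.Properties
open import Data.Product using (Σ; _×_; _,_)
open import Data.Sum using (inj₁; inj₂)
open import Function.Base using (_∘_)
open import Function.Bundles using (_⇔_; _↔_; Inverse; Injection; Equivalence; mk⇔; mk↔ₛ′)
open import Function.Construct.Composition using (_↔-∘_)
open import Function.Construct.Identity using (↔-id; ⇔-id)
open import Function.Construct.Symmetry using (↔-sym; ⇔-sym)
open import Function.Definitions using (Injective)
open import Function.Properties.Inverse using (↔⇒↣)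
open import Relation.Binary.Core using (_Preserves_⟶_)
open import Relation.Binary.Definitions using (tri<; tri≈; tri>)
open import Relation.Binary.PropositionalEquality
open import Relation.Nullary using (yes; no; contradiction)

open Inverse using (to; from; strictlyInverseˡ; strictlyInverseʳ)

↔-injective : {A B : Set} (e : A ↔ B) → Injective _≡_ _≡_ (to e)
↔-injective e = Injection.injective (↔⇒↣ e)

strictBound : {A : Set} → (A → ℕ) → List A → ℕ
strictBound g as = suc (max 0 (map g as))

<-strictBound : {A : Set} (g : A → ℕ) (as : List A) {a : A} → a ∈ as → g a < strictBound g as
<-strictBound g as a∈as = s≤s (All.lookup (xs≤max 0 (map g as)) (∈-map⁺ g a∈as))

reflects-< : {h : ℕ → ℕ} → h Preserves _<_ ⟶ _<_ → ∀ {i j} → h i < h j → i < j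
reflects-< h-mono {i} {j} hi<hj with <-cmp i j
... | tri< i<j _ _ = i<j
... | tri≈ _ refl _ = contradiction hi<hj (<-irrefl refl)
... | tri> _ _ j<i = contradiction (h-mono j<i) (<-asym hi<hj)

swap : ℕ → ℕ → ℕ → ℕ
swap a b x with x ≟ a | x ≟ b
... | yes _ | _     = b
... | no _  | yes _ = a
... | no _  | no _  = x

swap-≡ˡ : ∀ a b → swap a b a ≡ b
swap-≡ˡ a b with a ≟ a
... | yes _   = refl
... | no a≢a  = contradiction refl a≢a

swap-≡ʳ : ∀ a b → swap a b b ≡ a
swap-≡ʳ a b with b ≟ a | b ≟ b
... | yes b≡a | _       = b≡a
... | no _    | yes _   = refl
... | no _    | no b≢b  = contradiction refl b≢b

swap-≢ : ∀ {a b x} → x ≢ a → x ≢ b → swap a b x ≡ x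
swap-≢ {a} {b} {x} x≢a x≢b with x ≟ a | x ≟ b
... | yes x≡a | _       = contradiction x≡a x≢a
... | no _    | yes x≡b = contradiction x≡b x≢b
... | no _    | no _    = refl

swap-involutive : ∀ a b x → swap a b (swap a b x) ≡ x
swap-involutive a b x with x ≟ a | x ≟ b
... | yes refl | _        = swap-≡ʳ x b
... | no _     | yes refl = swap-≡ˡ a x
... | no x≢a   | no x≢b   = swap-≢ x≢a x≢b

transposition : ℕ → ℕ → ℕ ↔ ℕ
transposition a b = mk↔ₛ′ (swap a b) (swap a b) (swap-involutive a b) (swap-involutive a b)

module Alignment (h : ℕ → ℕ) (h-injective : Injective _≡_ _≡_ h) where

  align : ℕ → ℕ ↔ ℕ
  align zero    = ↔-id ℕ
  align (suc n) = transposition (to (align n) (h n)) n ↔-∘ align n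

  align-image : ∀ {n i} → i < n → to (align n) (h i) ≡ i
  align-image {suc n} {i} i<1+n with m<1+n⇒m<n∨m≡n i<1+n
  ... | inj₂ refl = swap-≡ˡ (to (align i) (h i)) i
  ... | inj₁ i<n  = trans (cong (swap c n) (align-image i<n)) (swap-≢ i≢c (<⇒≢ i<n))
    where
      c = to (align n) (h n)
      i≢c : i ≢ c
      i≢c i≡c = <⇒≢ i<n (h-injective (↔-injective (align n) (trans (align-image i<n) i≡c)))

  align-fixes : ∀ {n x} → n ≤ x → (∀ {i} → i < n → x ≢ h i) → to (align n) x ≡ x
  align-fixes {zero}  _     _       = refl
  align-fixes {suc n} {x} 1+n≤x x∉h[<1+n] =
    trans (cong (swap c n) fixed) (swap-≢ x≢c (≢-sym (<⇒≢ 1+n≤x)))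
    where
      c = to (align n) (h n)
      fixed : to (align n) x ≡ x
      fixed = align-fixes (<⇒≤ 1+n≤x) (x∉h[<1+n] ∘ m<n⇒m<1+n)
      x≢c : x ≢ c
      x≢c x≡c = x∉h[<1+n] (n<1+n n) (↔-injective (align n) (trans fixed x≡c))

exceeds-predecessors⇒n≤h[n] : {h : ℕ → ℕ} → Injective _≡_ _≡_ h →
                              ∀ {n} → (∀ {i} → i < n → h i < h n) → n ≤ h n
exceeds-predecessors⇒n≤h[n] {h} h-injective {n} h[<n]<h[n] =
  s≤s⁻¹ (injective⇒≤ {f = φ} φ-injective)
  where
    h≤h[n] : (k : Fin (suc n)) → h (toℕ k) < suc (h n)
    h≤h[n] k with m<1+n⇒m<n∨m≡n (toℕ<n k)
    ... | inj₁ k<n  = m<n⇒m<1+n (h[<n]<h[n] k<n)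
    ... | inj₂ k≡n  = s≤s (≤-reflexive (cong h k≡n))
    φ : Fin (suc n) → Fin (suc (h n))
    φ k = fromℕ< (h≤h[n] k)
    φ-injective : Injective _≡_ _≡_ φ
    φ-injective {k} {l} φk≡φl = toℕ-injective (h-injective (begin
      h (toℕ k)       ≡⟨ toℕ-fromℕ< (h≤h[n] k) ⟨
      toℕ (φ k)       ≡⟨ cong toℕ φk≡φl ⟩
      toℕ (φ l)       ≡⟨ toℕ-fromℕ< (h≤h[n] l) ⟩
      h (toℕ l)       ∎))
      where open ≡-Reasoning

IncreasingFrom : ℕ → (ℕ → ℕ) → Set
IncreasingFrom K h = ∀ {i j} → K ≤ i → i < j → h i < h j

n≤h[K+n] : ∀ {K h} → IncreasingFrom K h → ∀ n → n ≤ h (K + n)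
n≤h[K+n] h-increasing zero    = z≤n
n≤h[K+n] {K} {h} h-increasing (suc n) = begin
  suc n           ≤⟨ s≤s (n≤h[K+n] h-increasing n) ⟩
  suc (h (K + n)) ≤⟨ h-increasing (m≤m+n K n) (n<1+n (K + n)) ⟩
  h (suc (K + n)) ≡⟨ cong h (+-suc K n) ⟨
  h (K + suc n)   ∎
  where open ≤-Reasoning

module Straightening (h : ℕ → ℕ) (h-injective : Injective _≡_ _≡_ h)
                     (K : ℕ) (h-increasing : IncreasingFrom K h) where
  open Alignment h h-injective

  T : ℕ
  T = K + strictBound h (upTo K)

  K≤T : K ≤ T
  K≤T = m≤m+n K _

  h[≥T]-exceeds-predecessors : ∀ {j} → T ≤ j → ∀ {i} → i < j → h i < h j
  h[≥T]-exceeds-predecessors {j} T≤j {i} i<j with i <? K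
  ... | no i≮K  = h-increasing (≮⇒≥ i≮K) i<j
  ... | yes i<K = begin-strict
    h i                    <⟨ <-strictBound h (upTo K) (∈-upTo⁺ i<K) ⟩
    strictBound h (upTo K) ≡⟨ m+n∸m≡n K _ ⟨
    T ∸ K                  ≤⟨ ∸-monoˡ-≤ K T≤j ⟩
    j ∸ K                  ≤⟨ n≤h[K+n] h-increasing (j ∸ K) ⟩
    h (K + (j ∸ K))        ≡⟨ cong h (m+[n∸m]≡n (≤-trans K≤T T≤j)) ⟩
    h j                    ∎
    where open ≤-Reasoning

  T≤h[≥T] : ∀ {j} → T ≤ j → T ≤ h j
  T≤h[≥T] T≤j =
    ≤-trans T≤j (exceeds-predecessors⇒n≤h[n] h-injective (h[≥T]-exceeds-predecessors T≤j))

  σ : ℕ ↔ ℕ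
  σ = align T

  σ-fixes-h[≥T] : ∀ {j} → T ≤ j → to σ (h j) ≡ h j
  σ-fixes-h[≥T] T≤j = align-fixes (T≤h[≥T] T≤j)
    (λ i<T h[j]≡h[i] → <⇒≱ i<T (subst (T ≤_) (h-injective h[j]≡h[i]) T≤j))

  σ∘h-increasing : (to σ ∘ h) Preserves _<_ ⟶ _<_
  σ∘h-increasing {i} {j} i<j with i <? T | j <? T
  ... | yes i<T | yes j<T
    rewrite align-image i<T | align-image j<T = i<j
  ... | yes i<T | no j≮T
    rewrite align-image i<T | σ-fixes-h[≥T] (≮⇒≥ j≮T) = <-≤-trans i<T (T≤h[≥T] (≮⇒≥ j≮T))
  ... | no i≮T  | _
    rewrite σ-fixes-h[≥T] (≮⇒≥ i≮T) | σ-fixes-h[≥T] (≤-trans (≮⇒≥ i≮T) (<⇒≤ i<j)) =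
      h-increasing (≤-trans K≤T (≮⇒≥ i≮T)) i<j

  support : List ℕ
  support = map h (upTo T) ++ upTo T

  σ-fixes : ∀ {x} → x ∉ support → to σ x ≡ x
  σ-fixes {x} x∉support = align-fixes T≤x x∉h[<T]
    where
      T≤x : T ≤ x
      T≤x = ≮⇒≥ (λ x<T → x∉support (∈-++⁺ʳ (map h (upTo T)) (∈-upTo⁺ x<T)))
      x∉h[<T] : ∀ {i} → i < T → x ≢ h i
      x∉h[<T] i<T refl = x∉support (∈-++⁺ˡ (∈-map⁺ h (∈-upTo⁺ i<T)))

module Transfer {X Y : Set} {_<X_ : Rel X} {_<Y_ : Rel Y}
                (ι : X → Y) (ι-injective : Injective _≡_ _≡_ ι)
                (g : X ↔ ℕ) (g-iso : ∀ a b → (a <X b) ⇔ (to g a < to g b))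
                (f : Y ↔ ℕ) (f-iso : ∀ x y → (x <Y y) ⇔ (to f x < to f y)) where

  ιℕ : ℕ → ℕ
  ιℕ = to f ∘ ι ∘ from g

  ιℕ∘g : ∀ a → ιℕ (to g a) ≡ to f (ι a)
  ιℕ∘g a = cong (to f ∘ ι) (strictlyInverseʳ g a)

  ιℕ-injective : Injective _≡_ _≡_ ιℕ
  ιℕ-injective e = ↔-injective (↔-sym g) (ι-injective (↔-injective f e))

  ιℕ-increasing : (X₀ : List X) → (∀ a b → a ∉ X₀ → b ∉ X₀ → (a <X b) ⇔ (ι a <Y ι b)) →
                  IncreasingFrom (strictBound (to g) X₀) ιℕ
  ιℕ-increasing X₀ X₀-agrees {i} {j} K≤i i<j =
    Equivalence.to (f-iso _ _)
      (Equivalence.to (X₀-agrees _ _ (∉X₀ K≤i) (∉X₀ (≤-trans K≤i (<⇒≤ i<j))))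
        (Equivalence.from (g-iso _ _)
          (subst₂ _<_ (sym (strictlyInverseˡ g i)) (sym (strictlyInverseˡ g j)) i<j)))
    where
      ∉X₀ : ∀ {k} → strictBound (to g) X₀ ≤ k → from g k ∉ X₀
      ∉X₀ {k} K≤k k∈X₀ =
        <⇒≱ (subst (_< _) (strictlyInverseˡ g k) (<-strictBound (to g) X₀ k∈X₀)) K≤k

  module Pullback (σ : ℕ ↔ ℕ) where

    _⋖_ : Rel Y
    x ⋖ y = to σ (to f x) < to σ (to f y)

    ⋖-orderTypeω : OrderTypeω Y _⋖_
    ⋖-orderTypeω = σ ↔-∘ f , λ _ _ → ⇔-id _

    ⋖-almostAgree : (support : List ℕ) → (∀ {n} → n ∉ support → to σ n ≡ n) →
                    AlmostAgree Y _⋖_ _<Y_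
    ⋖-almostAgree support σ-fixes = map (from f) support , agree
      where
        σ-fixes-f : ∀ {x} → x ∉ map (from f) support → to σ (to f x) ≡ to f x
        σ-fixes-f {x} x∉ = σ-fixes λ fx∈ →
          x∉ (subst (_∈ _) (strictlyInverseʳ f x) (∈-map⁺ (from f) fx∈))
        agree : ∀ x y → x ∉ map (from f) support → y ∉ map (from f) support →
                (x ⋖ y) ⇔ (x <Y y)
        agree x y x∉ y∉ rewrite σ-fixes-f x∉ | σ-fixes-f y∉ = ⇔-sym (f-iso x y)

    ⋖-restrict : (to σ ∘ ιℕ) Preserves _<_ ⟶ _<_ → ∀ a b → Restrict ι _⋖_ a b ⇔ (a <X b)
    ⋖-restrict σ∘ιℕ-increasing a b rewrite sym (ιℕ∘g a) | sym (ιℕ∘g b) =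
      mk⇔ (Equivalence.from (g-iso a b) ∘ reflects-< σ∘ιℕ-increasing)
          (σ∘ιℕ-increasing ∘ Equivalence.to (g-iso a b))

lemmaA3 : (X Y : Set) (ι : X → Y) → Injective _≡_ _≡_ ι →
          (_<X_ : Rel X) (_<Y_ : Rel Y) →
          OrderTypeω X _<X_ → OrderTypeω Y _<Y_ →
          AlmostAgree X _<X_ (Restrict ι _<Y_) →
          Σ (Rel Y) λ _⋖_ →
            OrderTypeω Y _⋖_ × AlmostAgree Y _⋖_ _<Y_ ×
            (∀ a b → Restrict ι _⋖_ a b ⇔ (a <X b))
lemmaA3 X Y ι ι-injective _<X_ _<Y_ (g , g-iso) (f , f-iso) (X₀ , X₀-agrees) =
  _⋖_ , ⋖-orderTypeω , ⋖-almostAgree support σ-fixes , ⋖-restrict σ∘h-increasing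
  where
    open Transfer ι ι-injective g g-iso f f-iso
    open Straightening ιℕ ιℕ-injective _ (ιℕ-increasing X₀ X₀-agrees)
    open Pullback σ
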